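{- Let $\mathcal{M}$ be a matroid and let $e,f,g\in E(\mathcal{M})$ be distinct elements. If $\{e,f,g\}$ is dependent in $\mathcal{M}$, then every coefficient of the polynomial $$\Theta M\{e,f|g\}:=M_e^{fg}M_{fg}^{e}+M_f^{eg}M_{eg}^{f}-M_g^{ef}M_{ef}^{g}-M_{efg}M^{efg}$$ is nonnegative.
   Context: Let $\mathcal{M}$ be a matroid on a finite ground set $E$, with indeterminates $\mathbf{y}=\{y_c:c\in E\}$; for $A\subseteq E$ write $\mathbf{y}^A=\prod_{e\in A}y_e$. For disjoint $I,J\subseteq E$ let $\mathcal{M}_I^J=\{B\setminus I : B \text{ a basis of } \mathcal{M},\ I\subseteq B\subseteq E\setminus J\}$ (empty if $I$ is dependent) and $M_I^J(\mathbf{y})=\sum_{A\in\mathcal{M}_I^J}\mathbf{y}^A$; subscripts and superscripts list the elements of $I$ and $J$ (e.g. $M_e^{fg}=M_{\{e\}}^{\{f,g\}}$, $M_{efg}=M_{\{e,f,g\}}^{\emptyset}$, $M^{efg}=M_{\emptyset}^{\{e,f,g\}}$). -}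

module Defs where

open import Data.Nat using (ℕ; zero; suc; _+_)
import Data.Nat.Properties as ℕP
open import Data.Integer using (ℤ; +_) renaming (_+_ to _+ℤ_; _-_ to _-ℤ_)
open import Data.Bool using (Bool; true; false; if_then_else_)
open import Data.Fin using (Fin)
open import Data.Fin.Subset using (Subset; _∈_; _∉_; _⊆_; _∪_; _∩_; _─_; ∁; ⁅_⁆; _-_)
open import Data.Fin.Subset.Properties using (_⊆?_)
open import Data.Vec using (Vec; []; _∷_; zipWith) renaming (map to vmap)
open import Data.Vec.Properties using (≡-dec)
open import Data.List using (List; []; _∷_; _++_; map; filter; length; cartesianProduct)
open import Data.Product using (Σ; ∃; ∃-syntax; _×_; _,_; proj₁; proj₂)
open import Relation.Nullary using (¬_; Dec)
open import Relation.Nullary.Decidable using (_×-dec_)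
open import Relation.Unary using (Decidable)
open import Relation.Binary.PropositionalEquality using (_≡_)

record Matroid (n : ℕ) : Set₁ where
  field
    IsBasis       : Subset n → Set
    isBasis?      : Decidable IsBasis
    basis-exists  : ∃ IsBasis
    exchange      : ∀ {B₁ B₂} → IsBasis B₁ → IsBasis B₂ →
                    ∀ {x} → x ∈ B₁ → x ∉ B₂ →
                    ∃[ y ] (y ∈ B₂ × y ∉ B₁ × IsBasis ((B₁ - x) ∪ ⁅ y ⁆))

open Matroid public

Independent : ∀ {n} → Matroid n → Subset n → Set
Independent M I = ∃[ B ] (IsBasis M B × I ⊆ B)

Dependent : ∀ {n} → Matroid n → Subset n → Set
Dependent M I = ¬ Independent M I

allSubsets : (n : ℕ) → List (Subset n)
allSubsets zero    = [] ∷ []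
allSubsets (suc n) = map (false ∷_) (allSubsets n) ++ map (true ∷_) (allSubsets n)

-- the family  M_I^J = { B ∖ I : B basis, I ⊆ B ⊆ E ∖ J }   (as a list; B ↦ B ∖ I is injective here)
fam : ∀ {n} → Matroid n → (I J : Subset n) → List (Subset n)
fam {n} M I J =
  map (λ B → B ─ I)
      (filter (λ B → isBasis? M B ×-dec (I ⊆? B) ×-dec (B ⊆? ∁ J)) (allSubsets n))

-- exponent vector of the monomial y^A
expo : ∀ {n} → Subset n → Vec ℕ n
expo = vmap (λ b → if b then 1 else 0)

_⊕_ : ∀ {n} → Vec ℕ n → Vec ℕ n → Vec ℕ n
_⊕_ = zipWith _+_

-- coefficient of the monomial y^α in the product (Σ_{A∈F} y^A)(Σ_{B∈G} y^B)
coeffProd : ∀ {n} → List (Subset n) → List (Subset n) → Vec ℕ n → ℕ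
coeffProd F G α =
  length (filter (λ p → ≡-dec ℕP._≟_ (expo (proj₁ p) ⊕ expo (proj₂ p)) α)
                 (cartesianProduct F G))

coeffMM : ∀ {n} → Matroid n → (I J K L : Subset n) → Vec ℕ n → ℕ
coeffMM M I J K L = coeffProd (fam M I J) (fam M K L)

∅ : ∀ {n} → Subset n
∅ {zero}  = []
∅ {suc n} = false ∷ ∅

ΘCoeff : ∀ {n} → Matroid n → (e f g : Fin n) → Vec ℕ n → ℤ
ΘCoeff M e f g α =
  ((+ coeffMM M ⁅ e ⁆ (⁅ f ⁆ ∪ ⁅ g ⁆) (⁅ f ⁆ ∪ ⁅ g ⁆) ⁅ e ⁆ α)
   +ℤ (+ coeffMM M ⁅ f ⁆ (⁅ e ⁆ ∪ ⁅ g ⁆) (⁅ e ⁆ ∪ ⁅ g ⁆) ⁅ f ⁆ α))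
  -ℤ (+ coeffMM M ⁅ g ⁆ (⁅ e ⁆ ∪ ⁅ f ⁆) (⁅ e ⁆ ∪ ⁅ f ⁆) ⁅ g ⁆ α)
  -ℤ (+ coeffMM M (⁅ e ⁆ ∪ ⁅ f ⁆ ∪ ⁅ g ⁆) ∅ ∅ (⁅ e ⁆ ∪ ⁅ f ⁆ ∪ ⁅ g ⁆) α)

-- Coefficientwise, the last product of Θ M{e,f|g} vanishes because no basis contains the
-- dependent set {e,f,g}, and every pair (X, Y) counted by M_g^{ef} M_{ef}^g is counted again,
-- unchanged, by M_e^{fg} M_{fg}^e or by M_f^{eg} M_{eg}^f. Indeed, for X = B₁ ∖ g and
-- Y = B₂ ∖ {e,f} some x ∈ {e,f} makes both B₁ - g + x and B₂ - x + g bases. This double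
-- exchange is forced by four single-exchange disjunctions, each found by growing a subset of
-- one basis to a basis inside it and the other basis and asking which of e, f, g it contains.
module Submission where

open import Defs
open import Data.Nat using (ℕ; suc; _≤_; _<_; z≤n; s≤s; _+_; _≟_)
open import Data.Nat.Properties using (≤-trans; ≤-reflexive; +-suc; module ≤-Reasoning)
open import Data.Nat.Induction using (<-wellFounded)
open import Induction.WellFounded using (Acc; acc)
open import Data.Integer using (+_; 0ℤ; +≤+) renaming (_+_ to _+ℤ_; _-_ to _-ℤ_; _≤_ to _≤ℤ_)
open import Data.Integer.Properties using (+-identityʳ; i≤j⇒0≤j-i)
open import Data.Bool using (true; false)
open import Data.Fin using (Fin; zero; suc)
open import Data.Fin.Subset
  using (Subset; _∈_; _∉_; _⊆_; _⊂_; _∪_; _─_; _-_; ∁; ⁅_⁆; ∣_∣; inside; outside)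
  renaming (⊥ to ∅ˢ)
open import Data.Fin.Subset.Properties
  using ( _∈?_; _⊆?_; nonempty?; x∈⁅x⁆; x∈⁅y⁆⇒x≡y; x∉⁅y⁆⇒x≢y; p⊆p∪q; q⊆p∪q; x∈p∪q⁻
        ; p─q⊆p; x∈p∧x∉q⇒x∈p─q; x∈p∧x≢y⇒x∈p-y; x∈∁p⇒x∉p; x∉p⇒x∈∁p; x∉∁p⇒x∈p
        ; p⊂q⇒∣p∣<∣q∣; ⊆-antisym; ⊆-trans; ∪-comm; ∪-identityʳ; p─⊥≡p; p─q─r≡p─q∪r )
open import Data.Vec using (Vec; []; _∷_; here; there)
open import Data.Vec.Properties using (≡-dec; ∷-injectiveʳ)
open import Data.List using (List; []; _∷_; _++_; map; filter; length; cartesianProduct)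
open import Data.List.Properties using (length-++)
open import Data.List.Membership.Propositional using () renaming (_∈_ to _∈ˡ_; _∉_ to _∉ˡ_)
open import Data.List.Membership.Propositional.Properties
  using (∈-map⁺; ∈-map⁻; ∈-++⁺ˡ; ∈-++⁺ʳ; ∈-++⁻; ∈-∃++; ∈-filter⁺; ∈-filter⁻
        ; ∈-cartesianProduct⁺; ∈-cartesianProduct⁻; ∈-map∘filter⁺; ∈-map∘filter⁻)
import Data.List.Relation.Unary.Any as Any
import Data.List.Relation.Unary.All as All
open import Data.List.Relation.Unary.All.Properties using (¬Any⇒All¬)
open import Data.List.Relation.Unary.Unique.Propositional using (Unique; []; _∷_)
open import Data.List.Relation.Unary.Unique.Propositional.Properties
  using (++⁺; filter⁺; cartesianProduct⁺) renaming (map⁺ to Unique-map⁺)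
open import Data.Product using (∃-syntax; _×_; _,_; proj₁; proj₂)
open import Data.Sum using (_⊎_; inj₁; inj₂; [_,_]) renaming (map to ⊎-map)
open import Data.Empty using (⊥-elim)
open import Function using (_∘_)
open import Relation.Nullary using (¬_; yes; no; contradiction)
open import Relation.Nullary.Decidable using (_×-dec_)
open import Relation.Unary using (Decidable)
open import Relation.Binary.PropositionalEquality
  using (_≡_; _≢_; refl; sym; trans; cong; subst; ≢-sym; module ≡-Reasoning)

private variable
  n : ℕ

∪-least : ∀ {p q r : Subset n} → p ⊆ r → q ⊆ r → p ∪ q ⊆ r
∪-least {p = p} {q} p⊆r q⊆r x∈p∪q with x∈p∪q⁻ p q x∈p∪q
... | inj₁ x∈p = p⊆r x∈p
... | inj₂ x∈q = q⊆r x∈q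

∪-absorbs-⊆ : ∀ {p q r : Subset n} → q ⊆ r → (p ∪ q) ∪ r ⊆ p ∪ r
∪-absorbs-⊆ {p = p} {r = r} q⊆r =
  ∪-least (∪-least (p⊆p∪q r) (⊆-trans q⊆r (q⊆p∪q p r))) (q⊆p∪q p r)

⁅x⁆⊆p : ∀ {x : Fin n} {p} → x ∈ p → ⁅ x ⁆ ⊆ p
⁅x⁆⊆p {x = x} x∈p y∈⁅x⁆ rewrite x∈⁅y⁆⇒x≡y x y∈⁅x⁆ = x∈p

x∈⁅x⁆∪p : ∀ {x : Fin n} {p} → x ∈ ⁅ x ⁆ ∪ p
x∈⁅x⁆∪p {x = x} {p} = p⊆p∪q p (x∈⁅x⁆ x)

x∈p∪⁅x⁆ : ∀ {x : Fin n} {p} → x ∈ p ∪ ⁅ x ⁆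
x∈p∪⁅x⁆ {x = x} {p} = q⊆p∪q p ⁅ x ⁆ (x∈⁅x⁆ x)

x∈⁅y⁆∪⁅z⁆⁻ : ∀ {x y z : Fin n} → x ∈ ⁅ y ⁆ ∪ ⁅ z ⁆ → x ≡ y ⊎ x ≡ z
x∈⁅y⁆∪⁅z⁆⁻ {y = y} {z} = ⊎-map (x∈⁅y⁆⇒x≡y y) (x∈⁅y⁆⇒x≡y z) ∘ x∈p∪q⁻ ⁅ y ⁆ ⁅ z ⁆

x∈p─q⇒x∉q : ∀ {x : Fin n} (p q : Subset n) → x ∈ p ─ q → x ∉ q
x∈p─q⇒x∉q (inside ∷ p) (outside ∷ q) here        ()
x∈p─q⇒x∉q (_ ∷ p)      (_ ∷ q)       (there x∈) (there x∈q) = x∈p─q⇒x∉q p q x∈ x∈q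

⊆∁⁅x⁆ : ∀ {x : Fin n} {p} → x ∉ p → p ⊆ ∁ ⁅ x ⁆
⊆∁⁅x⁆ {x = x} x∉p {y} y∈p = x∉p⇒x∈∁p λ y∈⁅x⁆ → x∉p (subst (_∈ _) (x∈⁅y⁆⇒x≡y x y∈⁅x⁆) y∈p)

⊆∁⁅x⁆∪⁅y⁆ : ∀ {x y : Fin n} {p} → x ∉ p → y ∉ p → p ⊆ ∁ (⁅ x ⁆ ∪ ⁅ y ⁆)
⊆∁⁅x⁆∪⁅y⁆ x∉p y∉p z∈p = x∉p⇒x∈∁p
  ([ (λ { refl → x∉p z∈p }) , (λ { refl → y∉p z∈p }) ] ∘ x∈⁅y⁆∪⁅z⁆⁻)

─-cancelʳ-⊆ : ∀ {p q r : Subset n} → r ⊆ q → p ─ r ≡ q ─ r → p ⊆ q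
─-cancelʳ-⊆ {p = p} {q} {r} r⊆q p─r≡q─r {z} z∈p with z ∈? r
... | yes z∈r = r⊆q z∈r
... | no  z∉r = p─q⊆p q r (subst (z ∈_) p─r≡q─r (x∈p∧x∉q⇒x∈p─q z∈p z∉r))

p∪⁅x⁆-x≡p : ∀ {x : Fin n} {p} → x ∉ p → (p ∪ ⁅ x ⁆) - x ≡ p
p∪⁅x⁆-x≡p {x = zero}  {inside ∷ p}  x∉p = ⊥-elim (x∉p here)
p∪⁅x⁆-x≡p {x = zero}  {outside ∷ p} _   =
  cong (outside ∷_) (trans (cong (_─ ∅ˢ) (∪-identityʳ p)) (p─⊥≡p p))
p∪⁅x⁆-x≡p {x = suc x} {inside ∷ p}  x∉p = cong (inside ∷_) (p∪⁅x⁆-x≡p (x∉p ∘ there))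
p∪⁅x⁆-x≡p {x = suc x} {outside ∷ p} x∉p = cong (outside ∷_) (p∪⁅x⁆-x≡p (x∉p ∘ there))

infix 9 _[_↦_]

_[_↦_] : Subset n → Fin n → Fin n → Subset n
B [ x ↦ y ] = (B - x) ∪ ⁅ y ⁆

∈-[↦]⁻ : ∀ {B} {x y z : Fin n} → z ∈ B [ x ↦ y ] → (z ∈ B × z ≢ x) ⊎ z ≡ y
∈-[↦]⁻ {B = B} {x} {y} z∈ with x∈p∪q⁻ (B - x) ⁅ y ⁆ z∈
... | inj₁ z∈B-x = inj₁ (p─q⊆p B ⁅ x ⁆ z∈B-x , x∉⁅y⁆⇒x≢y (x∈p─q⇒x∉q B ⁅ x ⁆ z∈B-x))
... | inj₂ z∈⁅y⁆ = inj₂ (x∈⁅y⁆⇒x≡y y z∈⁅y⁆)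

∈-[↦]⁺ : ∀ {B} {x y z : Fin n} → z ∈ B → z ≢ x → z ∈ B [ x ↦ y ]
∈-[↦]⁺ {B = B} {y = y} z∈B z≢x = p⊆p∪q ⁅ y ⁆ (x∈p∧x≢y⇒x∈p-y z∈B z≢x)

y∈[x↦y] : ∀ {B} {x y : Fin n} → y ∈ B [ x ↦ y ]
y∈[x↦y] {B = B} {x} {y} = q⊆p∪q (B - x) ⁅ y ⁆ (x∈⁅x⁆ y)

x∉[x↦y] : ∀ {B} {x y : Fin n} → x ≢ y → x ∉ B [ x ↦ y ]
x∉[x↦y] x≢y x∈ with ∈-[↦]⁻ x∈
... | inj₁ (_ , x≢x) = x≢x refl
... | inj₂ x≡y       = x≢y x≡y

∉-[↦] : ∀ {B} {x y z : Fin n} → z ∉ B → z ≢ y → z ∉ B [ x ↦ y ]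
∉-[↦] z∉B z≢y z∈ with ∈-[↦]⁻ z∈
... | inj₁ (z∈B , _) = z∉B z∈B
... | inj₂ z≡y       = z≢y z≡y

⊆-[↦] : ∀ {A B} {x y : Fin n} → A ⊆ B → x ∉ A → A ⊆ B [ x ↦ y ]
⊆-[↦] A⊆B x∉A z∈A = ∈-[↦]⁺ (A⊆B z∈A) λ { refl → x∉A z∈A }

[↦]-excess-⊂ : ∀ {A B T} {x y : Fin n} → y ∈ T → x ∈ B ─ (A ∪ T) →
               B [ x ↦ y ] ─ (A ∪ T) ⊂ B ─ (A ∪ T)
[↦]-excess-⊂ {A = A} {B} {T} {x} {y} y∈T x∈excess = shrinks , x , x∈excess , x∉excess′
  where
  x∉A∪T : x ∉ A ∪ T
  x∉A∪T = x∈p─q⇒x∉q B (A ∪ T) x∈excess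

  shrinks : B [ x ↦ y ] ─ (A ∪ T) ⊆ B ─ (A ∪ T)
  shrinks z∈ with ∈-[↦]⁻ (p─q⊆p _ (A ∪ T) z∈)
  ... | inj₁ (z∈B , _) = x∈p∧x∉q⇒x∈p─q z∈B (x∈p─q⇒x∉q _ (A ∪ T) z∈)
  ... | inj₂ refl      = contradiction (q⊆p∪q A T y∈T) (x∈p─q⇒x∉q _ (A ∪ T) z∈)

  x∉excess′ : x ∉ B [ x ↦ y ] ─ (A ∪ T)
  x∉excess′ x∈ with ∈-[↦]⁻ (p─q⊆p _ (A ∪ T) x∈)
  ... | inj₁ (_ , x≢x) = x≢x refl
  ... | inj₂ refl      = x∉A∪T (q⊆p∪q A T y∈T)

allSubsets-complete : ∀ (p : Subset n) → p ∈ˡ allSubsets n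
allSubsets-complete []                  = Any.here refl
allSubsets-complete {suc n} (false ∷ p) = ∈-++⁺ˡ (∈-map⁺ (false ∷_) (allSubsets-complete p))
allSubsets-complete {suc n} (true ∷ p)  =
  ∈-++⁺ʳ (map (false ∷_) (allSubsets n)) (∈-map⁺ (true ∷_) (allSubsets-complete p))

allSubsets-unique : ∀ n → Unique (allSubsets n)
allSubsets-unique 0       = All.[] ∷ []
allSubsets-unique (suc n) =
  ++⁺ (Unique-map⁺ ∷-injectiveʳ (allSubsets-unique n)) (Unique-map⁺ ∷-injectiveʳ (allSubsets-unique n))
      λ (p∈ , q∈) → heads-differ (∈-map⁻ (false ∷_) p∈) (∈-map⁻ (true ∷_) q∈)
  where
  heads-differ : ∀ {p : Subset (suc n)} → ∃[ q ] (q ∈ˡ allSubsets n × p ≡ false ∷ q) →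
                 ¬ (∃[ q ] (q ∈ˡ allSubsets n × p ≡ true ∷ q))
  heads-differ (_ , _ , refl) (_ , _ , ())

Unique-map⁺-on : ∀ {A B : Set} {f : A → B} {xs} → Unique xs →
                 (∀ {x y} → x ∈ˡ xs → y ∈ˡ xs → f x ≡ f y → x ≡ y) → Unique (map f xs)
Unique-map⁺-on []               _   = []
Unique-map⁺-on {f = f} {x ∷ xs} (x∉xs ∷ xs-unique) inj =
  ¬Any⇒All¬ (map f xs) fx∉ ∷ Unique-map⁺-on xs-unique (λ p q → inj (Any.there p) (Any.there q))
  where
  fx∉ : f x ∉ˡ map f xs
  fx∉ fx∈ with ∈-map⁻ f fx∈
  ... | y , y∈xs , fx≡fy with inj (Any.here refl) (Any.there y∈xs) fx≡fy
  ...   | refl = All.lookup x∉xs y∈xs refl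

length-mono-⊆ : ∀ {A : Set} {xs ys : List A} → Unique xs → (∀ {x} → x ∈ˡ xs → x ∈ˡ ys) →
                length xs ≤ length ys
length-mono-⊆ {xs = []}     _                  _     = z≤n
length-mono-⊆ {xs = x ∷ xs} (x∉xs ∷ xs-unique) xs⊆ys with ∈-∃++ (xs⊆ys (Any.here refl))
... | ys₁ , ys₂ , refl = begin
  suc (length xs)                 ≤⟨ s≤s (length-mono-⊆ xs-unique xs⊆ys₁++ys₂) ⟩
  suc (length (ys₁ ++ ys₂))       ≡⟨ cong suc (length-++ ys₁) ⟩
  suc (length ys₁ + length ys₂)   ≡⟨ sym (+-suc (length ys₁) (length ys₂)) ⟩
  length ys₁ + length (x ∷ ys₂)   ≡⟨ sym (length-++ ys₁) ⟩
  length (ys₁ ++ x ∷ ys₂)         ∎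
  where
  open ≤-Reasoning
  xs⊆ys₁++ys₂ : ∀ {z} → z ∈ˡ xs → z ∈ˡ ys₁ ++ ys₂
  xs⊆ys₁++ys₂ z∈xs with ∈-++⁻ ys₁ (xs⊆ys (Any.there z∈xs))
  ... | inj₁ z∈ys₁             = ∈-++⁺ˡ z∈ys₁
  ... | inj₂ (Any.here refl)   = contradiction refl (All.lookup x∉xs z∈xs)
  ... | inj₂ (Any.there z∈ys₂) = ∈-++⁺ʳ ys₁ z∈ys₂

coeffProd-≤ : ∀ {F G F₁ G₁ F₂ G₂ : List (Subset n)} (α : Vec ℕ n) → Unique F → Unique G →
              (∀ {X Y} → X ∈ˡ F → Y ∈ˡ G → (X ∈ˡ F₁ × Y ∈ˡ G₁) ⊎ (X ∈ˡ F₂ × Y ∈ˡ G₂)) →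
              coeffProd F G α ≤ coeffProd F₁ G₁ α + coeffProd F₂ G₂ α
coeffProd-≤ {n} {F} {G} {F₁} {G₁} {F₂} {G₂} α F-unique G-unique split =
  ≤-trans (length-mono-⊆ (filter⁺ hits? (cartesianProduct⁺ F-unique G-unique)) ⊆L₁++L₂)
          (≤-reflexive (length-++ L₁))
  where
  hits? : Decidable λ (p : Subset n × Subset n) → expo (proj₁ p) ⊕ expo (proj₂ p) ≡ α
  hits? p = ≡-dec _≟_ (expo (proj₁ p) ⊕ expo (proj₂ p)) α

  L₁ L₂ : List (Subset n × Subset n)
  L₁ = filter hits? (cartesianProduct F₁ G₁)
  L₂ = filter hits? (cartesianProduct F₂ G₂)

  ⊆L₁++L₂ : ∀ {p} → p ∈ˡ filter hits? (cartesianProduct F G) → p ∈ˡ L₁ ++ L₂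
  ⊆L₁++L₂ p∈ with ∈-filter⁻ hits? {xs = cartesianProduct F G} p∈
  ... | p∈F×G , hit with ∈-cartesianProduct⁻ F G p∈F×G
  ...   | X∈F , Y∈G with split X∈F Y∈G
  ...     | inj₁ (X∈F₁ , Y∈G₁) = ∈-++⁺ˡ (∈-filter⁺ hits? (∈-cartesianProduct⁺ X∈F₁ Y∈G₁) hit)
  ...     | inj₂ (X∈F₂ , Y∈G₂) = ∈-++⁺ʳ L₁ (∈-filter⁺ hits? (∈-cartesianProduct⁺ X∈F₂ Y∈G₂) hit)

module _ (M : Matroid n) where

  basis-between : ∀ {A S T} → IsBasis M S → IsBasis M T → A ⊆ S →
                  ∃[ X ] (IsBasis M X × A ⊆ X × X ⊆ A ∪ T)
  basis-between {A} {T = T} S-basis T-basis = go (<-wellFounded _) S-basis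
    where
    go : ∀ {S} → Acc _<_ ∣ S ─ (A ∪ T) ∣ → IsBasis M S → A ⊆ S →
         ∃[ X ] (IsBasis M X × A ⊆ X × X ⊆ A ∪ T)
    go {S} (acc smaller) S-basis A⊆S with nonempty? (S ─ (A ∪ T))
    ... | no no-excess = S , S-basis , A⊆S , λ z∈S → x∉∁p⇒x∈p λ z∈∁ →
          no-excess (_ , x∈p∧x∉q⇒x∈p─q z∈S (x∈∁p⇒x∉p z∈∁))
    ... | yes (w , w∈excess)
      with exchange M S-basis T-basis (p─q⊆p S (A ∪ T) w∈excess)
                    (x∈p─q⇒x∉q S (A ∪ T) w∈excess ∘ q⊆p∪q A T)
    ...   | y , y∈T , _ , S′-basis =
            go (smaller (p⊂q⇒∣p∣<∣q∣ ([↦]-excess-⊂ y∈T w∈excess))) S′-basis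
               (⊆-[↦] A⊆S (x∈p─q⇒x∉q S (A ∪ T) w∈excess ∘ p⊆p∪q T))

  exchange-into : ∀ {A B X x} → IsBasis M B → IsBasis M X → X ⊆ A ∪ B → x ∈ B → x ∉ X →
                  ∃[ y ] (y ∈ A × IsBasis M (B [ x ↦ y ]))
  exchange-into {A} {B} B-basis X-basis X⊆A∪B x∈B x∉X
    with exchange M B-basis X-basis x∈B x∉X
  ... | y , y∈X , y∉B , B′-basis with x∈p∪q⁻ A B (X⊆A∪B y∈X)
  ...   | inj₁ y∈A = y , y∈A , B′-basis
  ...   | inj₂ y∈B = contradiction y∈B y∉B

  NoBasisContains : Fin n → Fin n → Fin n → Set
  NoBasisContains a b c = ∀ {B} → IsBasis M B → a ∈ B → b ∈ B → c ∉ B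

  no-basis-contains : ∀ {e f g} → Dependent M (⁅ e ⁆ ∪ ⁅ f ⁆ ∪ ⁅ g ⁆) → NoBasisContains e f g
  no-basis-contains dep B-basis e∈B f∈B g∈B =
    dep (_ , B-basis , ∪-least (⁅x⁆⊆p e∈B) (∪-least (⁅x⁆⊆p f∈B) (⁅x⁆⊆p g∈B)))

  module _ {g B₁ B₂} (B₁-basis : IsBasis M B₁) (B₂-basis : IsBasis M B₂) (g∈B₁ : g ∈ B₁) where

    Swaps₁ Swaps₂ : Fin n → Set
    Swaps₁ x = IsBasis M (B₁ [ g ↦ x ])
    Swaps₂ x = IsBasis M (B₂ [ x ↦ g ])

    swaps₂-from : ∀ {X x} → IsBasis M X → X ⊆ ⁅ g ⁆ ∪ B₂ → x ∈ B₂ → x ∉ X → Swaps₂ x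
    swaps₂-from X-basis X⊆ x∈B₂ x∉X with exchange-into B₂-basis X-basis X⊆ x∈B₂ x∉X
    ... | y , y∈⁅g⁆ , B₂′-basis with x∈⁅y⁆⇒x≡y g y∈⁅g⁆
    ...   | refl = B₂′-basis

    swaps₂-via : ∀ {a b B} → NoBasisContains a b g → a ∈ B₂ → b ∈ B₂ →
                 IsBasis M B → g ∈ B → b ∈ B → Swaps₂ a
    swaps₂-via no-abg a∈B₂ b∈B₂ B-basis g∈B b∈B
      with basis-between B-basis B₂-basis (∪-least (⁅x⁆⊆p g∈B) (⁅x⁆⊆p b∈B))
    ... | X , X-basis , gb⊆X , X⊆gb∪B₂ =
      swaps₂-from X-basis (⊆-trans X⊆gb∪B₂ (∪-absorbs-⊆ (⁅x⁆⊆p b∈B₂))) a∈B₂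
        (λ a∈X → no-abg X-basis a∈X (gb⊆X x∈p∪⁅x⁆) (gb⊆X x∈⁅x⁆∪p))

    swaps₂-either : ∀ {e f} → NoBasisContains e f g → e ∈ B₂ → f ∈ B₂ → Swaps₂ e ⊎ Swaps₂ f
    swaps₂-either {e} no-efg e∈B₂ f∈B₂ with basis-between B₁-basis B₂-basis (⁅x⁆⊆p g∈B₁)
    ... | X , X-basis , g⊆X , X⊆ with e ∈? X
    ...   | no  e∉X = inj₁ (swaps₂-from X-basis X⊆ e∈B₂ e∉X)
    ...   | yes e∈X = inj₂ (swaps₂-via (λ B-basis f∈B e∈B → no-efg B-basis e∈B f∈B)
                                       f∈B₂ e∈B₂ X-basis (g⊆X (x∈⁅x⁆ g)) e∈X)

    swaps₁-either : ∀ {e f} → NoBasisContains e f g → e ∈ B₂ → f ∈ B₂ → Swaps₁ e ⊎ Swaps₁ f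
    swaps₁-either no-efg e∈B₂ f∈B₂
      with basis-between B₂-basis B₁-basis (∪-least (⁅x⁆⊆p e∈B₂) (⁅x⁆⊆p f∈B₂))
    ... | X , X-basis , ef⊆X , X⊆
      with exchange-into B₁-basis X-basis X⊆ g∈B₁ (no-efg X-basis (ef⊆X x∈⁅x⁆∪p) (ef⊆X x∈p∪⁅x⁆))
    ...   | y , y∈ef , B₁′-basis with x∈⁅y⁆∪⁅z⁆⁻ y∈ef
    ...     | inj₁ refl = inj₁ B₁′-basis
    ...     | inj₂ refl = inj₂ B₁′-basis

    swaps₂-or-swaps₁ : ∀ {a b} → NoBasisContains a b g → a ∈ B₂ → b ∈ B₂ → Swaps₂ a ⊎ Swaps₁ b
    swaps₂-or-swaps₁ {b = b} no-abg a∈B₂ b∈B₂ with basis-between B₂-basis B₁-basis (⁅x⁆⊆p b∈B₂)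
    ... | X , X-basis , b⊆X , X⊆ with g ∈? X
    ...   | yes g∈X = inj₁ (swaps₂-via no-abg a∈B₂ b∈B₂ X-basis g∈X (b⊆X (x∈⁅x⁆ b)))
    ...   | no  g∉X with exchange-into B₁-basis X-basis X⊆ g∈B₁ g∉X
    ...     | y , y∈⁅b⁆ , B₁′-basis with x∈⁅y⁆⇒x≡y b y∈⁅b⁆
    ...       | refl = inj₂ B₁′-basis

    swaps-both : ∀ {e f} → NoBasisContains e f g → e ∈ B₂ → f ∈ B₂ →
                 (Swaps₁ e × Swaps₂ e) ⊎ (Swaps₁ f × Swaps₂ f)
    swaps-both no-efg e∈B₂ f∈B₂
      with swaps₂-either no-efg e∈B₂ f∈B₂ | swaps₁-either no-efg e∈B₂ f∈B₂
         | swaps₂-or-swaps₁ no-efg e∈B₂ f∈B₂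
         | swaps₂-or-swaps₁ (λ B-basis f∈B e∈B → no-efg B-basis e∈B f∈B) f∈B₂ e∈B₂
    ... | inj₁ s₂e | _        | _        | inj₂ s₁e = inj₁ (s₁e , s₂e)
    ... | inj₁ s₂e | inj₁ s₁e | _        | inj₁ _   = inj₁ (s₁e , s₂e)
    ... | inj₁ _   | inj₂ s₁f | _        | inj₁ s₂f = inj₂ (s₁f , s₂f)
    ... | inj₂ s₂f | _        | inj₂ s₁f | _        = inj₂ (s₁f , s₂f)
    ... | inj₂ s₂f | inj₂ s₁f | inj₁ _   | _        = inj₂ (s₁f , s₂f)
    ... | inj₂ _   | inj₁ s₁e | inj₁ s₂e | _        = inj₁ (s₁e , s₂e)

  private
    IsFamBasis? : (I J : Subset n) → Decidable λ B → IsBasis M B × I ⊆ B × B ⊆ ∁ J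
    IsFamBasis? I J B = isBasis? M B ×-dec (I ⊆? B) ×-dec (B ⊆? ∁ J)

  ∈-fam⁺ : ∀ {I J B X} → IsBasis M B → I ⊆ B → B ⊆ ∁ J → B ─ I ≡ X → X ∈ˡ fam M I J
  ∈-fam⁺ {I} {J} {B} B-basis I⊆B B⊆∁J refl =
    ∈-map∘filter⁺ (_─ I) (IsFamBasis? I J)
      (B , allSubsets-complete B , refl , B-basis , I⊆B , B⊆∁J)

  ∈-fam⁻ : ∀ {I J X} → X ∈ˡ fam M I J → ∃[ B ] (IsBasis M B × I ⊆ B × B ⊆ ∁ J × X ≡ B ─ I)
  ∈-fam⁻ {I} {J} X∈fam with ∈-map∘filter⁻ (_─ I) (IsFamBasis? I J) {xs = allSubsets n} X∈fam
  ... | B , _ , X≡B─I , B-basis , I⊆B , B⊆∁J = B , B-basis , I⊆B , B⊆∁J , X≡B─I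

  fam-unique : ∀ {I J} → Unique (fam M I J)
  fam-unique {I} {J} = Unique-map⁺-on (filter⁺ (IsFamBasis? I J) (allSubsets-unique n)) ─I-injective
    where
    candidates : List (Subset n)
    candidates = filter (IsFamBasis? I J) (allSubsets n)

    ⊇I : ∀ {B} → B ∈ˡ candidates → I ⊆ B
    ⊇I = proj₁ ∘ proj₂ ∘ proj₂ ∘ ∈-filter⁻ (IsFamBasis? I J) {xs = allSubsets n}

    ─I-injective : ∀ {B B′} → B ∈ˡ candidates → B′ ∈ˡ candidates → B ─ I ≡ B′ ─ I → B ≡ B′
    ─I-injective B∈ B′∈ eq = ⊆-antisym (─-cancelʳ-⊆ (⊇I B′∈) eq) (─-cancelʳ-⊆ (⊇I B∈) (sym eq))

  fam-dependent : ∀ {I J} → Dependent M I → fam M I J ≡ []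
  fam-dependent {I} {J} I-dependent with fam M I J in eq
  ... | []    = refl
  ... | X ∷ _ with ∈-fam⁻ {I} {J} (subst (X ∈ˡ_) (sym eq) (Any.here refl))
  ...   | B , B-basis , I⊆B , _ = ⊥-elim (I-dependent (B , B-basis , I⊆B))

  ∈-fam-entering : ∀ {B g x o} → IsBasis M (B [ g ↦ x ]) → x ∉ B → o ∉ B → o ≢ x → x ≢ g →
                   B - g ∈ˡ fam M ⁅ x ⁆ (⁅ o ⁆ ∪ ⁅ g ⁆)
  ∈-fam-entering {B} {g} B′-basis x∉B o∉B o≢x x≢g =
    ∈-fam⁺ B′-basis (⁅x⁆⊆p y∈[x↦y])
      (⊆∁⁅x⁆∪⁅y⁆ (∉-[↦] o∉B o≢x) (x∉[x↦y] (≢-sym x≢g)))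
      (p∪⁅x⁆-x≡p (x∉B ∘ p─q⊆p B ⁅ g ⁆))

  ∈-fam-leaving : ∀ {B g x o} → IsBasis M (B [ x ↦ g ]) → x ∈ B → o ∈ B → g ∉ B → o ≢ x →
                  B ─ (⁅ x ⁆ ∪ ⁅ o ⁆) ∈ˡ fam M (⁅ o ⁆ ∪ ⁅ g ⁆) ⁅ x ⁆
  ∈-fam-leaving {B} {g} {x} {o} B′-basis x∈B o∈B g∉B o≢x =
    ∈-fam⁺ B′-basis (∪-least (⁅x⁆⊆p (∈-[↦]⁺ o∈B o≢x)) (⁅x⁆⊆p y∈[x↦y]))
      (⊆∁⁅x⁆ (x∉[x↦y] λ { refl → g∉B x∈B })) B′─og≡B─xo
    where
    open ≡-Reasoning
    B′─og≡B─xo : B [ x ↦ g ] ─ (⁅ o ⁆ ∪ ⁅ g ⁆) ≡ B ─ (⁅ x ⁆ ∪ ⁅ o ⁆)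
    B′─og≡B─xo = begin
      B [ x ↦ g ] ─ (⁅ o ⁆ ∪ ⁅ g ⁆) ≡⟨ cong (B [ x ↦ g ] ─_) (∪-comm ⁅ o ⁆ ⁅ g ⁆) ⟩
      B [ x ↦ g ] ─ (⁅ g ⁆ ∪ ⁅ o ⁆) ≡⟨ sym (p─q─r≡p─q∪r (B [ x ↦ g ]) ⁅ g ⁆ ⁅ o ⁆) ⟩
      B [ x ↦ g ] - g - o           ≡⟨ cong (_- o) (p∪⁅x⁆-x≡p (g∉B ∘ p─q⊆p B ⁅ x ⁆)) ⟩
      B - x - o                     ≡⟨ p─q─r≡p─q∪r B ⁅ x ⁆ ⁅ o ⁆ ⟩
      B ─ (⁅ x ⁆ ∪ ⁅ o ⁆)           ∎

  fam-pair-exchange : ∀ {e f g} → e ≢ f → e ≢ g → f ≢ g → Dependent M (⁅ e ⁆ ∪ ⁅ f ⁆ ∪ ⁅ g ⁆) →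
    ∀ {X Y} → X ∈ˡ fam M ⁅ g ⁆ (⁅ e ⁆ ∪ ⁅ f ⁆) → Y ∈ˡ fam M (⁅ e ⁆ ∪ ⁅ f ⁆) ⁅ g ⁆ →
    (X ∈ˡ fam M ⁅ e ⁆ (⁅ f ⁆ ∪ ⁅ g ⁆) × Y ∈ˡ fam M (⁅ f ⁆ ∪ ⁅ g ⁆) ⁅ e ⁆) ⊎
    (X ∈ˡ fam M ⁅ f ⁆ (⁅ e ⁆ ∪ ⁅ g ⁆) × Y ∈ˡ fam M (⁅ e ⁆ ∪ ⁅ g ⁆) ⁅ f ⁆)
  fam-pair-exchange {e} {f} {g} e≢f e≢g f≢g dep X∈ Y∈ with ∈-fam⁻ X∈ | ∈-fam⁻ Y∈
  ... | B₁ , B₁-basis , g⊆B₁ , B₁⊆∁ef , refl | B₂ , B₂-basis , ef⊆B₂ , B₂⊆∁g , refl =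
    ⊎-map (λ (s₁e , s₂e) → ∈-fam-entering s₁e e∉B₁ f∉B₁ (≢-sym e≢f) e≢g
                          , ∈-fam-leaving s₂e e∈B₂ f∈B₂ g∉B₂ (≢-sym e≢f))
          (λ (s₁f , s₂f) → ∈-fam-entering s₁f f∉B₁ e∉B₁ e≢f f≢g
                          , subst (_∈ˡ _) (cong (B₂ ─_) (∪-comm ⁅ f ⁆ ⁅ e ⁆))
                                  (∈-fam-leaving s₂f f∈B₂ e∈B₂ g∉B₂ e≢f))
          (swaps-both B₁-basis B₂-basis (g⊆B₁ (x∈⁅x⁆ g)) (no-basis-contains dep) e∈B₂ f∈B₂)
    where
    e∈B₂ : e ∈ B₂
    e∈B₂ = ef⊆B₂ x∈⁅x⁆∪p
    f∈B₂ : f ∈ B₂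
    f∈B₂ = ef⊆B₂ x∈p∪⁅x⁆
    e∉B₁ : e ∉ B₁
    e∉B₁ e∈B₁ = x∈∁p⇒x∉p (B₁⊆∁ef e∈B₁) x∈⁅x⁆∪p
    f∉B₁ : f ∉ B₁
    f∉B₁ f∈B₁ = x∈∁p⇒x∉p (B₁⊆∁ef f∈B₁) x∈p∪⁅x⁆
    g∉B₂ : g ∉ B₂
    g∉B₂ g∈B₂ = x∈∁p⇒x∉p (B₂⊆∁g g∈B₂) (x∈⁅x⁆ g)

0≤a+b-c-d : ∀ a b {c d} → c ≤ a + b → d ≡ 0 → 0ℤ ≤ℤ ((+ a) +ℤ (+ b)) -ℤ (+ c) -ℤ (+ d)
0≤a+b-c-d a b {c} c≤a+b refl =
  subst (0ℤ ≤ℤ_) (sym (+-identityʳ ((+ a) +ℤ (+ b) -ℤ (+ c)))) (i≤j⇒0≤j-i (+≤+ c≤a+b))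

lemma3p1 : ∀ {n} (M : Matroid n) (e f g : Fin n) →
             e ≢ f → e ≢ g → f ≢ g →
             Dependent M (⁅ e ⁆ ∪ ⁅ f ⁆ ∪ ⁅ g ⁆) →
             ∀ (α : Vec ℕ n) → 0ℤ ≤ℤ ΘCoeff M e f g α
lemma3p1 {n} M e f g e≢f e≢g f≢g dep α =
  0≤a+b-c-d (term ⁅ e ⁆ (⁅ f ⁆ ∪ ⁅ g ⁆)) (term ⁅ f ⁆ (⁅ e ⁆ ∪ ⁅ g ⁆))
            g-term-dominated dependent-term-vanishes
  where
  term : Subset n → Subset n → ℕ
  term I J = coeffMM M I J J I α

  g-term-dominated :
    term ⁅ g ⁆ (⁅ e ⁆ ∪ ⁅ f ⁆) ≤ term ⁅ e ⁆ (⁅ f ⁆ ∪ ⁅ g ⁆) + term ⁅ f ⁆ (⁅ e ⁆ ∪ ⁅ g ⁆)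
  g-term-dominated =
    coeffProd-≤ α (fam-unique M) (fam-unique M) (fam-pair-exchange M e≢f e≢g f≢g dep)

  dependent-term-vanishes : term (⁅ e ⁆ ∪ ⁅ f ⁆ ∪ ⁅ g ⁆) ∅ ≡ 0
  dependent-term-vanishes =
    cong (λ F → coeffProd F (fam M ∅ (⁅ e ⁆ ∪ ⁅ f ⁆ ∪ ⁅ g ⁆)) α) (fam-dependent M dep)
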